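{- Let $h>4$ be an integer and let $$\mathrm{decompose}(h)=\{(0,0),(0,h),(0,-h)\}\cup\Big\{\big(\pm\tfrac{f_1-f_2}{2},0\big)\;:\; f_1,f_2\in\mathbb{Z}_{>0},\ f_1f_2=h^2,\ f_1>f_2,\ f_1\equiv f_2 \pmod 2\Big\}.$$ Then the diameter of $\mathrm{decompose}(h)$ equals $h^2-1$ if $h$ is odd and equals $\frac{h^2}{2}-2$ if $h$ is even.
   Context: The diameter of a finite point set in the Euclidean plane is the largest Euclidean distance between two of its points. -}

module Defs where

open import Data.Nat as ℕ using (ℕ; _∸_; _%_; _/_)
open import Data.Integer as ℤ using (ℤ; +_; -_; _-_; _+_; _*_; _≤_)
open import Data.Product using (_×_; _,_; ∃; ∃-syntax)
open import Data.Sum using (_⊎_)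
open import Relation.Binary.PropositionalEquality using (_≡_)

Point : Set
Point = ℤ × ℤ

sqDist : Point → Point → ℤ
sqDist (x₁ , y₁) (x₂ , y₂) = (x₁ - x₂) * (x₁ - x₂) + (y₁ - y₂) * (y₁ - y₂)

PointSet : Set₁
PointSet = Point → Set

-- Since distances
-- are nonnegative, d ≤ D ⇔ d² ≤ D², so this is stated with squared distances.
IsDiameter : PointSet → ℕ → Set
IsDiameter S D =
  (∀ p q → S p → S q → sqDist p q ≤ + (D ℕ.* D)) ×
  (∃[ p ] ∃[ q ] (S p × S q × sqDist p q ≡ + (D ℕ.* D)))

data Factor (h : ℕ) : Point → Set where
  factorPt : (f₁ f₂ : ℕ) → 0 ℕ.< f₁ → 0 ℕ.< f₂ → f₁ ℕ.* f₂ ≡ h ℕ.* h →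
             f₂ ℕ.< f₁ → f₁ % 2 ≡ f₂ % 2 →
             (s : ℤ) → (s ≡ + 1 ⊎ s ≡ - + 1) →
             Factor h (s * + ((f₁ ∸ f₂) / 2) , + 0)

data Decompose (h : ℕ) : Point → Set where
  origin : Decompose h (+ 0 , + 0)
  top    : Decompose h (+ 0 , + h)
  bottom : Decompose h (+ 0 , - + h)
  fac    : ∀ {p} → Factor h p → Decompose h p

module Submission where

-- Every point of decompose(h) lies on a coordinate axis: the three points
-- (0,0), (0,±h) on the vertical one and the points (±(f₁-f₂)/2, 0) on the
-- horizontal one.  If all these points lie within distance M of the origin,
-- then any two of them are at distance at most 2M (two points on the same
-- axis by the triangle inequality, two points on different axes since
-- a² + b² ≤ 2M² ≤ (2M)²); and if (±M, 0) both belong to the set, the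
-- distance 2M is attained.  So the diameter is twice the largest half-gap
-- M = (f₁-f₂)/2, provided h ≤ M.

open import Defs
open import Data.Nat using (ℕ; _<_; _*_; _∸_; _%_; _/_)
open import Data.Product using (_×_)
open import Relation.Binary.PropositionalEquality using (_≡_)

open import Data.Nat using (zero; suc; _+_; _≤_; z≤n; s≤s; s≤s⁻¹; NonZero; >-nonZero)
open import Data.Nat.Properties
  using (≤-trans; +-mono-≤; *-mono-≤; *-monoʳ-≤; +-monoˡ-≤;
         +-identityʳ; *-identityˡ; *-identityʳ; m≤m+n; m≤m*n; ∸-mono;
         *-cancelʳ-≤; *-distribʳ-∸; 0≢1+n; <⇒≤pred; *-monoʳ-<; *-cancelʳ-<)
open import Data.Nat.DivMod using (m≡m%n+[m/n]*n; m*n/n≡m; m*n%n≡0; [m+kn]%n≡m%n; /-monoˡ-≤)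
open import Data.Nat.Tactic.RingSolver using (solve-∀)
open import Data.Integer as ℤ using (ℤ; +_; -[1+_]; ∣_∣)
open import Data.Integer.Properties using (+◃n≡+n; ∣i-j∣≤∣i∣+∣j∣; ∣-i∣≡∣i∣; abs-*; -1*i≡-i; neg-involutive)
  renaming (*-identityˡ to ℤ*-identityˡ; ≤-trans to ℤ≤-trans)
open import Data.Product using (_,_)
open import Data.Sum using (_⊎_; inj₁; inj₂)
open import Data.Empty using (⊥-elim)
open import Relation.Binary.PropositionalEquality using (refl; sym; trans; cong; cong₂; subst; module ≡-Reasoning)

sq : ℕ → ℕ
sq n = n * n

sq-mono : ∀ {a b} → a ≤ b → sq a ≤ sq b
sq-mono a≤b = *-mono-≤ a≤b a≤b

sq-abs : (a : ℤ) → a ℤ.* a ≡ + sq ∣ a ∣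
sq-abs (+ n)    = +◃n≡+n (n * n)
sq-abs -[1+ n ] = +◃n≡+n (suc n * suc n)

sqDist-≤-abs : ∀ x₁ y₁ x₂ y₂ →
  sqDist (x₁ , y₁) (x₂ , y₂) ℤ.≤ + (sq (∣ x₁ ∣ + ∣ x₂ ∣) + sq (∣ y₁ ∣ + ∣ y₂ ∣))
sqDist-≤-abs x₁ y₁ x₂ y₂ =
  subst (ℤ._≤ + (sq (∣ x₁ ∣ + ∣ x₂ ∣) + sq (∣ y₁ ∣ + ∣ y₂ ∣)))
    (sym (cong₂ ℤ._+_ (sq-abs (x₁ ℤ.- x₂)) (sq-abs (y₁ ℤ.- y₂))))
    (ℤ.+≤+ (+-mono-≤ (sq-mono (∣i-j∣≤∣i∣+∣j∣ x₁ x₂)) (sq-mono (∣i-j∣≤∣i∣+∣j∣ y₁ y₂))))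

sq-sum-≤ : ∀ {M a b} → a ≤ M → b ≤ M → sq (a + b) ≤ sq (M + M)
sq-sum-≤ a≤M b≤M = sq-mono (+-mono-≤ a≤M b≤M)

sq-add-sq-≤ : ∀ {M a b} → a ≤ M → b ≤ M → sq a + sq b ≤ sq (M + M)
sq-add-sq-≤ {M} a≤M b≤M =
  ≤-trans (+-mono-≤ (sq-mono a≤M) (sq-mono b≤M))
    (subst (sq M + sq M ≤_) (expand M) (m≤m+n (sq M + sq M) (sq M + sq M)))
  where
  expand : ∀ M → (M * M + M * M) + (M * M + M * M) ≡ (M + M) * (M + M)
  expand = solve-∀

+0-≤ : ∀ {a M} → a ≤ M → a + 0 ≤ M
+0-≤ {a} a≤M = subst (_≤ _) (sym (+-identityʳ a)) a≤M

data OnAxes (M : ℕ) : Point → Set where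
  horizontal : ∀ x → ∣ x ∣ ≤ M → OnAxes M (x , + 0)
  vertical   : ∀ y → ∣ y ∣ ≤ M → OnAxes M (+ 0 , y)

onAxes-sqDist-≤ : ∀ {M p q} → OnAxes M p → OnAxes M q → sqDist p q ℤ.≤ + sq (M + M)
onAxes-sqDist-≤ {M} (horizontal x₁ b₁) (horizontal x₂ b₂) =
  ℤ≤-trans (sqDist-≤-abs x₁ (+ 0) x₂ (+ 0))
    (ℤ.+≤+ (subst (_≤ sq (M + M)) (sym (+-identityʳ _)) (sq-sum-≤ b₁ b₂)))
onAxes-sqDist-≤ (horizontal x₁ b₁) (vertical y₂ b₂) =
  ℤ≤-trans (sqDist-≤-abs x₁ (+ 0) (+ 0) y₂) (ℤ.+≤+ (sq-add-sq-≤ (+0-≤ b₁) b₂))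
onAxes-sqDist-≤ (vertical y₁ b₁) (horizontal x₂ b₂) =
  ℤ≤-trans (sqDist-≤-abs (+ 0) y₁ x₂ (+ 0)) (ℤ.+≤+ (sq-add-sq-≤ b₂ (+0-≤ b₁)))
onAxes-sqDist-≤ (vertical y₁ b₁) (vertical y₂ b₂) =
  ℤ≤-trans (sqDist-≤-abs (+ 0) y₁ (+ 0) y₂) (ℤ.+≤+ (sq-sum-≤ b₁ b₂))

-- The antipodal points (m, 0) and (-m, 0), written with the signs ±1 used
-- in the definition of decompose(h), are at distance 2m.
antipodal-sqDist : ∀ m → sqDist (+ 1 ℤ.* + m , + 0) (ℤ.- + 1 ℤ.* + m , + 0) ≡ + sq (m + m)
antipodal-sqDist m = begin
  gap ℤ.* gap ℤ.+ + 0             ≡⟨ cong (λ g → g ℤ.* g ℤ.+ + 0) gap≡ ⟩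
  + (m + m) ℤ.* + (m + m) ℤ.+ + 0 ≡⟨ cong (ℤ._+ + 0) (sq-abs (+ (m + m))) ⟩
  + (sq (m + m) + 0)               ≡⟨ cong +_ (+-identityʳ _) ⟩
  + sq (m + m)                     ∎
  where
  open ≡-Reasoning
  gap : ℤ
  gap = (+ 1 ℤ.* + m) ℤ.- (ℤ.- + 1 ℤ.* + m)
  gap≡ : gap ≡ + (m + m)
  gap≡ = trans (cong₂ ℤ._-_ (ℤ*-identityˡ (+ m)) (-1*i≡-i (+ m)))
               (cong (ℤ._+_ (+ m)) (neg-involutive (+ m)))

onAxes-diameter : ∀ {S : PointSet} M → (∀ {p} → S p → OnAxes M p) →
  S (+ 1 ℤ.* + M , + 0) → S (ℤ.- + 1 ℤ.* + M , + 0) → IsDiameter S (M + M)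
onAxes-diameter M onAxes right left =
  (λ p q Sp Sq → onAxes-sqDist-≤ (onAxes Sp) (onAxes Sq)) ,
  (_ , _ , right , left , antipodal-sqDist M)

record ParityFactorisation (h : ℕ) : Set where
  constructor factorisation
  field
    f₁ f₂   : ℕ
    pos₁    : 0 < f₁
    pos₂    : 0 < f₂
    product : f₁ * f₂ ≡ h * h
    ordered : f₂ < f₁
    parity  : f₁ % 2 ≡ f₂ % 2

  halfGap : ℕ
  halfGap = (f₁ ∸ f₂) / 2

open ParityFactorisation

factor-point : ∀ {h} (F : ParityFactorisation h) (s : ℤ) → (s ≡ + 1 ⊎ s ≡ ℤ.- + 1) →
  Decompose h (s ℤ.* + halfGap F , + 0)
factor-point (factorisation f₁ f₂ p₁ p₂ prod ord par) s sign =
  fac (factorPt f₁ f₂ p₁ p₂ prod ord par s sign)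

∣±m∣≡m : ∀ s m → (s ≡ + 1 ⊎ s ≡ ℤ.- + 1) → ∣ s ℤ.* + m ∣ ≡ m
∣±m∣≡m .(+ 1)      m (inj₁ refl) = trans (abs-* (+ 1) (+ m)) (*-identityˡ m)
∣±m∣≡m .(ℤ.- + 1) m (inj₂ refl) = trans (abs-* (ℤ.- + 1) (+ m)) (*-identityˡ m)

decompose-onAxes : ∀ {h M} → h ≤ M → (∀ (F : ParityFactorisation h) → halfGap F ≤ M) →
  ∀ {p} → Decompose h p → OnAxes M p
decompose-onAxes h≤M gap≤M origin = vertical (+ 0) z≤n
decompose-onAxes h≤M gap≤M top    = vertical (+ _) h≤M
decompose-onAxes {h} h≤M gap≤M bottom =
  vertical (ℤ.- + h) (subst (_≤ _) (sym (∣-i∣≡∣i∣ (+ h))) h≤M)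
decompose-onAxes h≤M gap≤M (fac (factorPt f₁ f₂ p₁ p₂ prod ord par s sign)) =
  horizontal _ (subst (_≤ _) (sym (∣±m∣≡m s _ sign))
                      (gap≤M (factorisation f₁ f₂ p₁ p₂ prod ord par)))

decompose-diameter : ∀ {h M D} (F : ParityFactorisation h) → f₁ F ∸ f₂ F ≡ M * 2 →
  D ≡ M * 2 → h ≤ M → (∀ G → halfGap G ≤ halfGap F) → IsDiameter (Decompose h) D
decompose-diameter {h} {M} {D} F gap≡2M D≡2M h≤M maximal =
  subst (IsDiameter (Decompose h)) (sym D≡M+M)
    (onAxes-diameter (halfGap F)
      (decompose-onAxes (subst (h ≤_) (sym halfGap≡M) h≤M) maximal)
      (factor-point F (+ 1) (inj₁ refl)) (factor-point F (ℤ.- + 1) (inj₂ refl)))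
  where
  open ≡-Reasoning
  halfGap≡M : halfGap F ≡ M
  halfGap≡M = trans (cong (_/ 2) gap≡2M) (m*n/n≡m M 2)
  double : ∀ m → m * 2 ≡ m + m
  double = solve-∀
  D≡M+M : D ≡ halfGap F + halfGap F
  D≡M+M = begin
    D                     ≡⟨ D≡2M ⟩
    M * 2                 ≡⟨ double M ⟩
    M + M                 ≡⟨ cong (λ m → m + m) (sym halfGap≡M) ⟩
    halfGap F + halfGap F ∎

halfGap-mono : ∀ {f₁ f₂ N c} → f₁ ≤ N → c ≤ f₂ → (f₁ ∸ f₂) / 2 ≤ (N ∸ c) / 2
halfGap-mono f₁≤N c≤f₂ = /-monoˡ-≤ 2 (∸-mono f₁≤N c≤f₂)

factor-bound : ∀ {h} (F : ParityFactorisation h) {c} → c ≤ f₂ F → f₁ F * c ≤ h * h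
factor-bound F {c} c≤f₂ = subst (f₁ F * c ≤_) (product F) (*-monoʳ-≤ (f₁ F) c≤f₂)

-- Odd case, h = 2k + 1 with k ≥ 1: the extremal factorisation is h² = h² · 1,
-- with half-gap M = 2k² + 2k = (h² - 1)/2.
odd-diameter : ∀ k → 1 ≤ k → let h = suc (k * 2) in IsDiameter (Decompose h) (h * h ∸ 1)
odd-diameter k 1≤k = decompose-diameter F gap≡2M gap≡2M h≤M maximal
  where
  h = suc (k * 2)
  M = k * k * 2 + k * 2
  gap≡2M : h * h ∸ 1 ≡ M * 2
  gap≡2M = square k
    where
    square : ∀ k → k * 2 + k * 2 * (1 + k * 2) ≡ (k * k * 2 + k * 2) * 2
    square = solve-∀
  1<h² : 1 < h * h
  1<h² = ≤-trans (s≤s (≤-trans 1≤k (m≤m*n k 2))) (m≤m*n h h)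
  h²-odd : (h * h) % 2 ≡ 1 % 2
  h²-odd = trans (cong (λ n → suc n % 2) gap≡2M) ([m+kn]%n≡m%n 1 M 2)
  F : ParityFactorisation h
  F = factorisation (h * h) 1 (s≤s z≤n) (s≤s z≤n) (*-identityʳ (h * h)) 1<h² h²-odd
  h≤M : h ≤ M
  h≤M = +-monoˡ-≤ (k * 2) (*-mono-≤ (*-mono-≤ 1≤k 1≤k) (s≤s z≤n))
  maximal : ∀ G → halfGap G ≤ halfGap F
  maximal G = halfGap-mono f₁≤h² (pos₂ G)
    where
    f₁≤h² : f₁ G ≤ h * h
    f₁≤h² = subst (_≤ h * h) (*-identityʳ (f₁ G)) (factor-bound G (pos₂ G))

-- If h² is even, the parity condition excludes f₂ = 1, so f₂ ≥ 2.
even-square-f₂≥2 : ∀ {h} → (h * h) % 2 ≡ 0 → (G : ParityFactorisation h) → 2 ≤ f₂ G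
even-square-f₂≥2 even (factorisation f₁ zero _ () _ _ _)
even-square-f₂≥2 {h} even (factorisation f₁ (suc zero) _ _ prod _ par) = ⊥-elim (0≢1+n 0≡1)
  where
  open ≡-Reasoning
  0≡1 : 0 ≡ 1
  0≡1 = begin
    0             ≡⟨ sym even ⟩
    (h * h) % 2   ≡⟨ cong (_% 2) (sym prod) ⟩
    (f₁ * 1) % 2  ≡⟨ cong (_% 2) (*-identityʳ f₁) ⟩
    f₁ % 2        ≡⟨ par ⟩
    1             ∎
even-square-f₂≥2 even (factorisation _ (suc (suc _)) _ _ _ _ _) = s≤s (s≤s z≤n)

-- Even case, h = 2k with k ≥ 3: the extremal factorisation is h² = 2k² · 2,
-- with half-gap M = k² - 1 = (h²/2 - 2)/2.
even-diameter : ∀ k → 2 < k → let h = k * 2 in IsDiameter (Decompose h) ((h * h) / 2 ∸ 2)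
even-diameter k 2<k = decompose-diameter F gap≡2M D≡2M h≤M maximal
  where
  instance
    k≢0 : NonZero k
    k≢0 = >-nonZero (≤-trans (s≤s z≤n) 2<k)
  h = k * 2
  N = k * k * 2
  M = k * k ∸ 1
  h²≡N*2 : h * h ≡ N * 2
  h²≡N*2 = square k
    where
    square : ∀ k → k * 2 * (k * 2) ≡ k * k * 2 * 2
    square = solve-∀
  gap≡2M : N ∸ 2 ≡ M * 2
  gap≡2M = sym (*-distribʳ-∸ 2 (k * k) 1)
  D≡2M : (h * h) / 2 ∸ 2 ≡ M * 2
  D≡2M = begin
    (h * h) / 2 ∸ 2 ≡⟨ cong (λ n → n / 2 ∸ 2) h²≡N*2 ⟩
    N * 2 / 2 ∸ 2   ≡⟨ cong (_∸ 2) (m*n/n≡m N 2) ⟩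
    N ∸ 2           ≡⟨ gap≡2M ⟩
    M * 2           ∎
    where open ≡-Reasoning
  2<N : 2 < N
  2<N = ≤-trans 2<k (≤-trans (m≤m*n k k) (m≤m*n (k * k) 2))
  F : ParityFactorisation h
  F = factorisation N 2 (≤-trans (s≤s z≤n) 2<N) (s≤s z≤n) (sym h²≡N*2) 2<N (m*n%n≡0 (k * k) 2)
  h≤M : h ≤ M
  h≤M = <⇒≤pred (*-monoʳ-< k 2<k)
  maximal : ∀ G → halfGap G ≤ halfGap F
  maximal G = halfGap-mono f₁≤N f₂≥2
    where
    f₂≥2 : 2 ≤ f₂ G
    f₂≥2 = even-square-f₂≥2 (trans (cong (_% 2) h²≡N*2) (m*n%n≡0 N 2)) G
    f₁≤N : f₁ G ≤ N
    f₁≤N = *-cancelʳ-≤ (f₁ G) N 2 (subst (f₁ G * 2 ≤_) h²≡N*2 (factor-bound G f₂≥2))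

halve : ∀ {h r} → h % 2 ≡ r → h ≡ r + h / 2 * 2
halve {h} h%2≡r = trans (m≡m%n+[m/n]*n h 2) (cong (_+ h / 2 * 2) h%2≡r)

-- Write h = 2k + (h mod 2); then h > 4 gives k ≥ 1 in the odd case and
-- k ≥ 3 in the even case, and the two case lemmas apply.
mainTheorem2 : (h : ℕ) → 4 < h →
    (h % 2 ≡ 1 → IsDiameter (Decompose h) (h * h ∸ 1)) ×
    (h % 2 ≡ 0 → IsDiameter (Decompose h) ((h * h) / 2 ∸ 2))
mainTheorem2 h 4<h = odd , even
  where
  k = h / 2
  odd : h % 2 ≡ 1 → IsDiameter (Decompose h) (h * h ∸ 1)
  odd h%2≡1 = subst (λ n → IsDiameter (Decompose n) (n * n ∸ 1)) (sym h≡2k+1)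
                (odd-diameter k (*-cancelʳ-< 2 0 k 0<2k))
    where
    h≡2k+1 : h ≡ suc (k * 2)
    h≡2k+1 = halve h%2≡1
    0<2k : 0 < k * 2
    0<2k = ≤-trans (s≤s z≤n) (s≤s⁻¹ (subst (4 <_) h≡2k+1 4<h))
  even : h % 2 ≡ 0 → IsDiameter (Decompose h) ((h * h) / 2 ∸ 2)
  even h%2≡0 = subst (λ n → IsDiameter (Decompose n) ((n * n) / 2 ∸ 2)) (sym h≡2k)
                 (even-diameter k (*-cancelʳ-< 2 2 k (subst (4 <_) h≡2k 4<h)))
    where
    h≡2k : h ≡ k * 2
    h≡2k = halve h%2≡0
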